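{- There exists a bijection $\pi\colon \mathcal P\to\mathcal S$ such that for every integer $n\ge 0$, $\pi(\mathcal P_n)=\mathcal S_{\operatorname{lg}=n}$. Moreover, for every $n\ge 0$, $\#\mathcal S_{\operatorname{lg}=n}=p(n)$.
   Context: $\mathcal P$ denotes the set of all integer partitions $\lambda=(\lambda_1,\dots,\lambda_r)$, $\lambda_1\ge\dots\ge\lambda_r\ge1$, including the empty partition $\emptyset$ (of size $0$ and length $0$). $\mathcal P_n$ is the set of partitions of $n$ and $p(n)=\#\mathcal P_n$. A partition $\lambda=(\lambda_1,\dots,\lambda_r)$ is called sequentially congruent if $\lambda_i\equiv\lambda_{i+1}\pmod i$ for $1\le i\le r-1$ and $\lambda_r\equiv 0\pmod r$. $\mathcal S\subseteq\mathcal P$ denotes the set of sequentially congruent partitions, and $\mathcal S_{\operatorname{lg}=n}$ the set of sequentially congruent partitions whose largest part $\lambda_1$ equals $n$ (with the empty partition regarded as having largest part $0$). -}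

module Defs where

open import Data.Nat using (ℕ; zero; suc; _≥_; _%_)
open import Data.List using (List; []; _∷_; length)
open import Data.Nat.ListAction using (sum)
open import Data.Product using (Σ; _×_)
open import Data.Unit using (⊤)
open import Relation.Binary.PropositionalEquality using (_≡_)

data Decreasing : List ℕ → Set where
  dec-[] : Decreasing []
  dec-[x] : ∀ {x} → Decreasing (x ∷ [])
  dec-∷ : ∀ {x y ys} → x ≥ y → Decreasing (y ∷ ys) → Decreasing (x ∷ y ∷ ys)

data AllPositive : List ℕ → Set where
  pos-[] : AllPositive []
  pos-∷ : ∀ {x xs} → x ≥ 1 → AllPositive xs → AllPositive (x ∷ xs)

IsPartition : List ℕ → Set
IsPartition xs = Decreasing xs × AllPositive xs

Partition : Set
Partition = Σ (List ℕ) IsPartition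

size : Partition → ℕ
size (xs Data.Product., _) = sum xs

largest : Partition → ℕ
largest ([] Data.Product., _) = 0
largest ((x ∷ _) Data.Product., _) = x

_≡_[mod-suc_] : ℕ → ℕ → ℕ → Set
a ≡ b [mod-suc k ] = a % suc k ≡ b % suc k

-- SeqCongFrom k xs: xs = (μ₁,…,μₛ) are the parts λ_{k+1},…,λ_r of λ, so the
-- part μⱼ sits at (1-indexed) position i = k + j. Conditions:
--   λᵢ ≡ λᵢ₊₁ (mod i) for consecutive parts, and λᵣ ≡ 0 (mod r).
SeqCongFrom : ℕ → List ℕ → Set
SeqCongFrom k [] = ⊤
SeqCongFrom k (x ∷ []) = x ≡ 0 [mod-suc k ]          -- position r = suc k
SeqCongFrom k (x ∷ y ∷ ys) = (x ≡ y [mod-suc k ]) × SeqCongFrom (suc k) (y ∷ ys)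

IsSeqCong : List ℕ → Set
IsSeqCong xs = SeqCongFrom 0 xs

SeqCongPartition : Set
SeqCongPartition = Σ Partition (λ p → IsSeqCong (Data.Product.proj₁ p))

PartitionOf : ℕ → Set
PartitionOf n = Σ Partition (λ p → size p ≡ n)

SeqCongLargest : ℕ → Set
SeqCongLargest n = Σ SeqCongPartition (λ s → largest (Data.Product.proj₁ s) ≡ n)

{-# OPTIONS --safe #-}
module Submission where

-- A nonempty partition λ₁ ≥ … ≥ λᵣ ≥ 1 is determined by its gaps dᵢ = λᵢ − λᵢ₊₁ (λᵣ₊₁ = 0, so dᵣ ≥ 1).
-- Put μᵢ = Σ_{j ≥ i} j dⱼ. Then μᵢ − μᵢ₊₁ = i dᵢ ≡ 0 (mod i) and μᵣ = r dᵣ ≡ 0 (mod r), so μ is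
-- sequentially congruent, and conversely every sequentially congruent μ arises from the gaps
-- dᵢ = (μᵢ − μᵢ₊₁) / i. Its largest part μ₁ = Σ j dⱼ equals |λ|, so λ ↦ μ maps 𝒫ₙ onto 𝒮_{lg=n};
-- 𝒫ₙ itself is finite because its members are lists of length ≤ n with entries ≤ n.

open import Defs
open import Data.Nat using (ℕ; NonZero; zero; suc; _+_; _*_; _∸_; _≤_; _≥_; z≤n; s≤s; _%_; _/_; _≤?_; _≟_)
open import Data.Nat.Properties
  using (≤-trans; ≤-irrelevant; ≡-irrelevant; m≤n+m; m≤m+n; m+n∸n≡m; m∸n+n≡m; +-mono-≤; +-comm; +-identityʳ; *-identityʳ; *-suc; *-distribʳ-∸; [m+n]∸[m+o]≡n∸o)
open import Data.Nat.DivMod using (m≡m%n+[m/n]*n; m*n/n≡m; m*n%n≡0; m/n*n≡m; %-remove-+ˡ)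
open import Data.Nat.Divisibility using (_∣_; divides; m%n≡0⇒n∣m; n∣m*n)
open import Data.Nat.ListAction using (sum)
open import Data.Nat.Tactic.RingSolver using (solve-∀)
open import Data.List using (List; []; _∷_; length; lookup; mapMaybe; deduplicate; cartesianProductWith; upTo)
open import Data.List.Properties using (∷-injectiveˡ; ≡-dec)
open import Data.List.Relation.Unary.All as All using (All; []; _∷_)
open import Data.List.Relation.Unary.AllPairs using ([]; _∷_)
open import Data.List.Relation.Unary.Any as Any using (here; there)
open import Data.List.Relation.Unary.Any.Properties using (mapMaybe⁺; map⁺)
open import Data.Maybe.Relation.Unary.Any as MaybeAny using (just)
open import Data.List.Relation.Unary.Unique.Propositional using (Unique)
open import Data.List.Relation.Unary.Unique.DecPropositional.Properties using (deduplicate-!)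
open import Data.List.Relation.Unary.Enumerates.Setoid.Properties using (deduplicate⁺; lookup-surjective)
open import Data.List.Membership.Propositional using (_∈_)
open import Data.List.Membership.Propositional.Properties using (∈-cartesianProductWith⁺; ∈-upTo⁺; ∈-lookup)
open import Data.Fin using (Fin; zero; suc)
open import Data.Maybe using (Maybe; just; nothing)
open import Data.Product using (Σ; ∃; _×_; _,_; proj₁; uncurry)
open import Data.Unit using (tt)
open import Data.Product.Function.Dependent.Propositional using (Σ-↔)
open import Relation.Nullary using (Dec; yes; no; Irrelevant; contradiction)
open import Relation.Nullary.Decidable using (map′; _×-dec_)
open import Relation.Binary.Definitions using (DecidableEquality)
open import Relation.Binary.PropositionalEquality
open import Relation.Binary.PropositionalEquality.Properties using (setoid; decSetoid)
open import Function.Definitions using (Injective)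
open import Function.Bundles using (_⤖_; _↔_; Bijection; Inverse; mk↔ₛ′; mk⤖)
open import Function.Properties.Inverse using (↔⇒⤖; ↔-refl; ↔-sym; ↔-trans)
open import Function.Properties.Bijection using (⤖⇒↔)

m%n≡o%n⇒n∣m∸o : ∀ {m o} n .{{_ : NonZero n}} → o ≤ m → m % n ≡ o % n → n ∣ m ∸ o
m%n≡o%n⇒n∣m∸o {m} {o} n o≤m m%n≡o%n = divides (m / n ∸ o / n) (begin
  m ∸ o                                      ≡⟨ cong₂ _∸_ (m≡m%n+[m/n]*n m n) (m≡m%n+[m/n]*n o n) ⟩
  (m % n + m / n * n) ∸ (o % n + o / n * n)  ≡⟨ cong (λ r → (r + m / n * n) ∸ (o % n + o / n * n)) m%n≡o%n ⟩
  (o % n + m / n * n) ∸ (o % n + o / n * n)  ≡⟨ [m+n]∸[m+o]≡n∸o (o % n) (m / n * n) (o / n * n) ⟩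
  m / n * n ∸ o / n * n                      ≡⟨ *-distribʳ-∸ n (m / n) (o / n) ⟨
  (m / n ∸ o / n) * n                        ∎)
  where open ≡-Reasoning

m%n≡0⇒suc[m/n∸1]*n≡m : ∀ {m} n .{{_ : NonZero n}} → m ≥ 1 → m % n ≡ 0 → suc (m / n ∸ 1) * n ≡ m
m%n≡0⇒suc[m/n∸1]*n≡m {m} n m≥1 m%n≡0 with m / n | m/n*n≡m (m%n≡0⇒n∣m m n m%n≡0)
... | zero  | 0≡m   = contradiction (subst (1 ≤_) (sym 0≡m) m≥1) λ ()
... | suc q | q*n≡m = q*n≡m

Σ-≡-irrelevant : ∀ {A : Set} {P : A → Set} → (∀ {a} → Irrelevant (P a)) →
                 {x y : Σ A P} → proj₁ x ≡ proj₁ y → x ≡ y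
Σ-≡-irrelevant irr {a , p} {.a , q} refl = cong (a ,_) (irr p q)

lookup-injective : ∀ {A : Set} {xs : List A} → Unique xs → Injective _≡_ _≡_ (lookup xs)
lookup-injective (_ ∷ _) {zero} {zero} _ = refl
lookup-injective (x∉xs ∷ _) {zero} {suc j} eq = contradiction eq (All.lookup x∉xs (∈-lookup j))
lookup-injective (x∉xs ∷ _) {suc i} {zero} eq = contradiction (sym eq) (All.lookup x∉xs (∈-lookup i))
lookup-injective (_ ∷ xs-unique) {suc i} {suc j} eq = cong suc (lookup-injective xs-unique eq)

enumeration⇒⤖Fin : ∀ {A : Set} → DecidableEquality A → (xs : List A) → (∀ a → a ∈ xs) →
                   ∃ λ k → A ⤖ Fin k
enumeration⇒⤖Fin {A} _≟A_ xs xs-complete = length ys , ↔⇒⤖ (↔-sym (⤖⇒↔ lookup-bijection))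
  where
  ys = deduplicate _≟A_ xs
  lookup-bijection : Fin (length ys) ⤖ A
  lookup-bijection = mk⤖ (lookup-injective (deduplicate-! _≟A_ xs) ,
                          lookup-surjective (setoid A) (deduplicate⁺ (decSetoid _≟A_) xs-complete))

∈-mapMaybe⁺ : ∀ {A B : Set} {f : A → Maybe B} {xs a b} → a ∈ xs → f a ≡ just b → b ∈ mapMaybe f xs
∈-mapMaybe⁺ {f = f} {xs} a∈xs fa≡b =
  mapMaybe⁺ f xs (map⁺ (Any.map (λ { refl → subst (MaybeAny.Any (_ ≡_)) (sym fa≡b) (just refl) }) a∈xs))

boundedLists : ℕ → ℕ → List (List ℕ)
boundedLists zero b = [] ∷ []
boundedLists (suc L) b = [] ∷ cartesianProductWith _∷_ (upTo (suc b)) (boundedLists L b)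

∈-boundedLists : ∀ {L b xs} → length xs ≤ L → All (_≤ b) xs → xs ∈ boundedLists L b
∈-boundedLists {zero} {xs = []} _ _ = here refl
∈-boundedLists {suc L} {xs = []} _ _ = here refl
∈-boundedLists {suc L} {xs = x ∷ xs} (s≤s length≤L) (x≤b ∷ xs≤b) =
  there (∈-cartesianProductWith⁺ _∷_ (∈-upTo⁺ (s≤s x≤b)) (∈-boundedLists length≤L xs≤b))

Decreasing-irrelevant : ∀ {xs} → Irrelevant (Decreasing xs)
Decreasing-irrelevant dec-[] dec-[] = refl
Decreasing-irrelevant dec-[x] dec-[x] = refl
Decreasing-irrelevant (dec-∷ p ps) (dec-∷ q qs) = cong₂ dec-∷ (≤-irrelevant p q) (Decreasing-irrelevant ps qs)

AllPositive-irrelevant : ∀ {xs} → Irrelevant (AllPositive xs)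
AllPositive-irrelevant pos-[] pos-[] = refl
AllPositive-irrelevant (pos-∷ p ps) (pos-∷ q qs) = cong₂ pos-∷ (≤-irrelevant p q) (AllPositive-irrelevant ps qs)

IsPartition-irrelevant : ∀ {xs} → Irrelevant (IsPartition xs)
IsPartition-irrelevant (d , p) (d′ , p′) = cong₂ _,_ (Decreasing-irrelevant d d′) (AllPositive-irrelevant p p′)

SeqCongFrom-irrelevant : ∀ k xs → Irrelevant (SeqCongFrom k xs)
SeqCongFrom-irrelevant k [] tt tt = refl
SeqCongFrom-irrelevant k (x ∷ []) p q = ≡-irrelevant p q
SeqCongFrom-irrelevant k (x ∷ y ∷ ys) (p , ps) (q , qs) =
  cong₂ _,_ (≡-irrelevant p q) (SeqCongFrom-irrelevant (suc k) (y ∷ ys) ps qs)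

partition-≡ : {p q : Partition} → proj₁ p ≡ proj₁ q → p ≡ q
partition-≡ = Σ-≡-irrelevant IsPartition-irrelevant

seqCongPartition-≡ : {s t : SeqCongPartition} → proj₁ (proj₁ s) ≡ proj₁ (proj₁ t) → s ≡ t
seqCongPartition-≡ eq = Σ-≡-irrelevant (SeqCongFrom-irrelevant 0 _) (partition-≡ eq)

length≤sum : ∀ {xs} → AllPositive xs → length xs ≤ sum xs
length≤sum pos-[] = z≤n
length≤sum (pos-∷ x≥1 xs-pos) = +-mono-≤ x≥1 (length≤sum xs-pos)

All-≤-sum : ∀ xs → All (_≤ sum xs) xs
All-≤-sum [] = []
All-≤-sum (x ∷ xs) = m≤m+n x (sum xs) ∷ All.map (λ y≤sum → ≤-trans y≤sum (m≤n+m (sum xs) x)) (All-≤-sum xs)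

decreasing? : ∀ xs → Dec (Decreasing xs)
decreasing? [] = yes dec-[]
decreasing? (x ∷ []) = yes dec-[x]
decreasing? (x ∷ y ∷ ys) =
  map′ (uncurry dec-∷) (λ { (dec-∷ y≤x ys-dec) → y≤x , ys-dec }) (y ≤? x ×-dec decreasing? (y ∷ ys))

allPositive? : ∀ xs → Dec (AllPositive xs)
allPositive? [] = yes pos-[]
allPositive? (x ∷ xs) =
  map′ (uncurry pos-∷) (λ { (pos-∷ x≥1 xs-pos) → x≥1 , xs-pos }) (1 ≤? x ×-dec allPositive? xs)

-- d₁ ∷ … ∷ dᵣ₋₁ ∷ last c encodes the gaps (d₁, …, dᵣ) with dᵣ = 1 + c; top and below give λᵢ = dᵢ + … + dᵣ.
data Gaps : Set where
  last : ℕ → Gaps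
  _∷_  : ℕ → Gaps → Gaps

top : Gaps → ℕ
top (last c) = suc c
top (d ∷ g) = d + top g

below : Gaps → List ℕ
below (last c) = []
below (d ∷ g) = top g ∷ below g

-- wtop k g is μₖ₊₁ = Σᵢ i dᵢ when the gaps of g sit at positions i = k+1, k+2, …
wtop : ℕ → Gaps → ℕ
wtop k (last c) = suc c * suc k
wtop k (d ∷ g) = d * suc k + wtop (suc k) g

wbelow : ℕ → Gaps → List ℕ
wbelow k (last c) = []
wbelow k (d ∷ g) = wtop (suc k) g ∷ wbelow (suc k) g

wtop-suc : ∀ k g → wtop (suc k) g ≡ wtop k g + top g
wtop-suc k (last c) = trans (*-suc (suc c) (suc k)) (+-comm (suc c) (suc c * suc k))
wtop-suc k (d ∷ g) = begin
  d * suc (suc k) + wtop (suc (suc k)) g      ≡⟨ cong (d * suc (suc k) +_) (wtop-suc (suc k) g) ⟩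
  d * suc (suc k) + (wtop (suc k) g + top g)  ≡⟨ regroup k d (wtop (suc k) g) (top g) ⟩
  (d * suc k + wtop (suc k) g) + (d + top g)  ∎
  where
  open ≡-Reasoning
  regroup : ∀ k d w t → d * suc (suc k) + (w + t) ≡ (d * suc k + w) + (d + t)
  regroup = solve-∀

-- Conjugation: |λ| = Σᵢ i dᵢ, each dᵢ being counted once in each of λ₁, …, λᵢ.
sum≡wtop : ∀ g → top g + sum (below g) ≡ wtop 0 g
sum≡wtop (last c) = trans (+-identityʳ (suc c)) (sym (*-identityʳ (suc c)))
sum≡wtop (d ∷ g) = begin
  (d + top g) + (top g + sum (below g))  ≡⟨ cong ((d + top g) +_) (sum≡wtop g) ⟩
  (d + top g) + wtop 0 g                 ≡⟨ regroup d (top g) (wtop 0 g) ⟩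
  d * 1 + (wtop 0 g + top g)             ≡⟨ cong (d * 1 +_) (wtop-suc 0 g) ⟨
  d * 1 + wtop 1 g                       ∎
  where
  open ≡-Reasoning
  regroup : ∀ d t w → (d + t) + w ≡ d * 1 + (w + t)
  regroup = solve-∀

top-positive : ∀ g → top g ≥ 1
top-positive (last c) = s≤s z≤n
top-positive (d ∷ g) = ≤-trans (top-positive g) (m≤n+m (top g) d)

parts-decreasing : ∀ g → Decreasing (top g ∷ below g)
parts-decreasing (last c) = dec-[x]
parts-decreasing (d ∷ g) = dec-∷ (m≤n+m (top g) d) (parts-decreasing g)

parts-positive : ∀ g → AllPositive (top g ∷ below g)
parts-positive (last c) = pos-∷ (s≤s z≤n) pos-[]
parts-positive (d ∷ g) = pos-∷ (top-positive (d ∷ g)) (parts-positive g)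

partition : Maybe Gaps → Partition
partition nothing = [] , dec-[] , pos-[]
partition (just g) = (top g ∷ below g) , parts-decreasing g , parts-positive g

gapsFrom : ℕ → List ℕ → Gaps
gapsFrom x [] = last (x ∸ 1)
gapsFrom x (y ∷ ys) = (x ∸ y) ∷ gapsFrom y ys

gaps : Partition → Maybe Gaps
gaps ([] , _) = nothing
gaps ((x ∷ xs) , _) = just (gapsFrom x xs)

gapsFrom-parts : ∀ g → gapsFrom (top g) (below g) ≡ g
gapsFrom-parts (last c) = refl
gapsFrom-parts (d ∷ g) = cong₂ _∷_ (m+n∸n≡m d (top g)) (gapsFrom-parts g)

parts-gapsFrom : ∀ {x xs} → Decreasing (x ∷ xs) → AllPositive (x ∷ xs) →
                 top (gapsFrom x xs) ∷ below (gapsFrom x xs) ≡ x ∷ xs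
parts-gapsFrom {suc x} {[]} _ _ = refl
parts-gapsFrom {x} {y ∷ ys} (dec-∷ y≤x ys-dec) (pos-∷ _ ys-pos) =
  cong₂ _∷_ (trans (cong (x ∸ y +_) (∷-injectiveˡ ih)) (m∸n+n≡m y≤x)) ih
  where ih = parts-gapsFrom ys-dec ys-pos

gaps-partition : ∀ m → gaps (partition m) ≡ m
gaps-partition nothing = refl
gaps-partition (just g) = cong just (gapsFrom-parts g)

partition-gaps : ∀ p → partition (gaps p) ≡ p
partition-gaps ([] , dec-[] , pos-[]) = refl
partition-gaps ((x ∷ xs) , d , p) = partition-≡ (parts-gapsFrom d p)

partition↔gaps : Partition ↔ Maybe Gaps
partition↔gaps = mk↔ₛ′ gaps partition gaps-partition partition-gaps

wtop-positive : ∀ k g → wtop k g ≥ 1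
wtop-positive k (last c) = s≤s z≤n
wtop-positive k (d ∷ g) = ≤-trans (wtop-positive (suc k) g) (m≤n+m _ (d * suc k))

wparts-decreasing : ∀ k g → Decreasing (wtop k g ∷ wbelow k g)
wparts-decreasing k (last c) = dec-[x]
wparts-decreasing k (d ∷ g) = dec-∷ (m≤n+m _ (d * suc k)) (wparts-decreasing (suc k) g)

wparts-positive : ∀ k g → AllPositive (wtop k g ∷ wbelow k g)
wparts-positive k (last c) = pos-∷ (s≤s z≤n) pos-[]
wparts-positive k (d ∷ g) = pos-∷ (wtop-positive k (d ∷ g)) (wparts-positive (suc k) g)

wparts-seqCong : ∀ k g → SeqCongFrom k (wtop k g ∷ wbelow k g)
wparts-seqCong k (last c) = m*n%n≡0 (suc c) (suc k)
wparts-seqCong k (d ∷ g) = %-remove-+ˡ (wtop (suc k) g) (n∣m*n d) , wparts-seqCong (suc k) g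

seqCong : Maybe Gaps → SeqCongPartition
seqCong nothing = ([] , dec-[] , pos-[]) , tt
seqCong (just g) = ((wtop 0 g ∷ wbelow 0 g) , wparts-decreasing 0 g , wparts-positive 0 g) , wparts-seqCong 0 g

wgapsFrom : ℕ → ℕ → List ℕ → Gaps
wgapsFrom k x [] = last (x / suc k ∸ 1)
wgapsFrom k x (y ∷ ys) = (x ∸ y) / suc k ∷ wgapsFrom (suc k) y ys

seqGaps : SeqCongPartition → Maybe Gaps
seqGaps (([] , _) , _) = nothing
seqGaps (((x ∷ xs) , _) , _) = just (wgapsFrom 0 x xs)

wgapsFrom-wparts : ∀ k g → wgapsFrom k (wtop k g) (wbelow k g) ≡ g
wgapsFrom-wparts k (last c) = cong (λ q → last (q ∸ 1)) (m*n/n≡m (suc c) (suc k))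
wgapsFrom-wparts k (d ∷ g) = cong₂ _∷_
  (trans (cong (_/ suc k) (m+n∸n≡m (d * suc k) (wtop (suc k) g))) (m*n/n≡m d (suc k)))
  (wgapsFrom-wparts (suc k) g)

wparts-wgapsFrom : ∀ {k x xs} → Decreasing (x ∷ xs) → AllPositive (x ∷ xs) → SeqCongFrom k (x ∷ xs) →
                   wtop k (wgapsFrom k x xs) ∷ wbelow k (wgapsFrom k x xs) ≡ x ∷ xs
wparts-wgapsFrom {k} {x} {[]} _ (pos-∷ x≥1 _) x%k≡0 = cong (_∷ []) (m%n≡0⇒suc[m/n∸1]*n≡m (suc k) x≥1 x%k≡0)
wparts-wgapsFrom {k} {x} {y ∷ ys} (dec-∷ y≤x ys-dec) (pos-∷ _ ys-pos) (x≡y , ys-cong) =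
  cong₂ _∷_ (begin
    (x ∸ y) / suc k * suc k + wtop (suc k) (wgapsFrom (suc k) y ys)  ≡⟨ cong (_ +_) (∷-injectiveˡ ih) ⟩
    (x ∸ y) / suc k * suc k + y                                        ≡⟨ cong (_+ y) (m/n*n≡m (m%n≡o%n⇒n∣m∸o (suc k) y≤x x≡y)) ⟩
    x ∸ y + y                                                          ≡⟨ m∸n+n≡m y≤x ⟩
    x                                                                  ∎) ih
  where
  open ≡-Reasoning
  ih = wparts-wgapsFrom ys-dec ys-pos ys-cong

seqGaps-seqCong : ∀ m → seqGaps (seqCong m) ≡ m
seqGaps-seqCong nothing = refl
seqGaps-seqCong (just g) = cong just (wgapsFrom-wparts 0 g)

seqCong-seqGaps : ∀ s → seqCong (seqGaps s) ≡ s
seqCong-seqGaps (([] , dec-[] , pos-[]) , tt) = refl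
seqCong-seqGaps (((x ∷ xs) , d , p) , c) = seqCongPartition-≡ (wparts-wgapsFrom d p c)

seqCong↔gaps : SeqCongPartition ↔ Maybe Gaps
seqCong↔gaps = mk↔ₛ′ seqGaps seqCong seqGaps-seqCong seqCong-seqGaps

π↔ : Partition ↔ SeqCongPartition
π↔ = ↔-trans partition↔gaps (↔-sym seqCong↔gaps)

largest-seqCong : ∀ m → largest (proj₁ (seqCong m)) ≡ size (partition m)
largest-seqCong nothing = refl
largest-seqCong (just g) = sym (sum≡wtop g)

largest∘π≡size : ∀ p → largest (proj₁ (Inverse.to π↔ p)) ≡ size p
largest∘π≡size p = trans (largest-seqCong (gaps p)) (cong size (partition-gaps p))

partitionOf↔seqCongLargest : ∀ n → PartitionOf n ↔ SeqCongLargest n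
partitionOf↔seqCongLargest n = Σ-↔ π↔ λ {p} →
  subst (λ m → (size p ≡ n) ↔ (m ≡ n)) (sym (largest∘π≡size p)) ↔-refl

asPartitionOf : ∀ n → List ℕ → Maybe (PartitionOf n)
asPartitionOf n xs with decreasing? xs ×-dec allPositive? xs | sum xs ≟ n
... | yes xs-partition | yes sum≡n = just ((xs , xs-partition) , sum≡n)
... | _                | _         = nothing

asPartitionOf-parts : ∀ n (a : PartitionOf n) → asPartitionOf n (proj₁ (proj₁ a)) ≡ just a
asPartitionOf-parts n ((xs , xs-partition) , sum≡n) with decreasing? xs ×-dec allPositive? xs | sum xs ≟ n
... | yes _              | yes _    = cong just (Σ-≡-irrelevant ≡-irrelevant (partition-≡ refl))
... | no ¬xs-partition   | _        = contradiction xs-partition ¬xs-partition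
... | yes _              | no sum≢n = contradiction sum≡n sum≢n

partitionOf-≟ : ∀ n → DecidableEquality (PartitionOf n)
partitionOf-≟ n a b = map′ (λ eq → Σ-≡-irrelevant ≡-irrelevant (partition-≡ eq)) (cong (λ c → proj₁ (proj₁ c)))
                           (≡-dec _≟_ (proj₁ (proj₁ a)) (proj₁ (proj₁ b)))

partitionOf-finite : ∀ n → ∃ λ k → PartitionOf n ⤖ Fin k
partitionOf-finite n =
  enumeration⇒⤖Fin (partitionOf-≟ n) (mapMaybe (asPartitionOf n) (boundedLists n n)) complete
  where
  complete : ∀ a → a ∈ mapMaybe (asPartitionOf n) (boundedLists n n)
  complete a@((xs , _ , xs-pos) , sum≡n) = ∈-mapMaybe⁺
    (subst (λ m → xs ∈ boundedLists m m) sum≡n (∈-boundedLists (length≤sum xs-pos) (All-≤-sum xs)))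
    (asPartitionOf-parts n a)

theorem2p1 : Σ (Partition ⤖ SeqCongPartition)
               (λ π → ∀ (n : ℕ) (p : Partition) →
                 size p ≡ n → largest (proj₁ (Bijection.to π p)) ≡ n)
             × (∀ (n : ℕ) → ∃ λ k → (PartitionOf n ⤖ Fin k) × (SeqCongLargest n ⤖ Fin k))
theorem2p1 = (↔⇒⤖ π↔ , λ n p size≡n → trans (largest∘π≡size p) size≡n) , λ n →
  let k , partitionOf⤖Fin = partitionOf-finite n
  in k , partitionOf⤖Fin , ↔⇒⤖ (↔-trans (↔-sym (partitionOf↔seqCongLargest n)) (⤖⇒↔ partitionOf⤖Fin))
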